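{- Let $\mathcal K$ be an extended $\mathcal{ALCHIQ}b$ knowledge base. Then the extended $\mathcal{ALCHI}b^{\le}$ knowledge base $\mathrm{Ege}(\mathcal K)$ and $\mathcal K$ are equisatisfiable.
   Context: Fix disjoint sets $N_C$, $N_R$, $N_I$. Atomic roles: $R\in N_R$ and $R^-$; $\mathrm{Inv}(R)=R^-$, $\mathrm{Inv}(R^-)=R$. Boolean role expressions: from atomic roles via $\neg,\sqcap,\sqcup$; $S\vdash U$ means $U$ is true when exactly the atomic roles in $S$ are true; $U$ restricted if $\emptyset\not\vdash U$. An extended $\mathcal{ALCHIQ}b$ knowledge base is a triple of a TBox (finite set of GCIs $C\sqsubseteq D$), an RBox (finite set of axioms $U\sqsubseteq V$ with $U,V$ restricted; no transitivity axioms) and a finite set of DL-safe rules. Concepts: concept names, $\top,\bot,\neg C,C\sqcap D,C\sqcup D,\forall U.C,\exists U.C$ ($U$ restricted), $\le n\,S.C$, $\ge(n+1)S.C$ ($S$ atomic role, $n\ge0$). Semantics: interpretations with nonempty domain; $R^-$ converse, $\neg U$ complement in $(\Delta^{\mathcal I})^2$, $\sqcap,\sqcup$ intersection/union; standard concept semantics; $\mathcal I\models U\sqsubseteq V$ iff $U^{\mathcal I}\subseteq V^{\mathcal I}$; GCIs as inclusion. A concept $C$ as axiom abbreviates $\top\sqsubseteq C$; $C\sqsubseteq D$ is identified with $\neg C\sqcup D$. DL-safe rules $B\to H$: conjunctions of atoms $A(t)$, $R(t,u)$ ($A\in N_C$, $R\in N_R$), $t\approx u$; satisfied if every assignment of variables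 to named elements $\{a^{\mathcal I}\}$ satisfying $B$ satisfies $H$ (empty body true, empty head false). Equisatisfiable: both or neither have a model. An extended $\mathcal{ALCHI}b^{\le}$ knowledge base is an extended $\mathcal{ALCHIQ}b$ knowledge base whose TBox axioms are concepts in negation normal form containing no $\ge$ restrictions. $\mathrm{NNF}$: push negation inwards ($\neg\le n\,R.C\mapsto\ge(n+1)R.C$, $\neg\ge n\,R.C\mapsto\le(n-1)R.C$, $\neg\exists\mapsto\forall\neg$, $\neg\forall\mapsto\exists\neg$, De Morgan). $\mathrm{FLAT}(\mathcal K)$: keep RBox and rules; replace each TBox axiom (as concept) by its NNF; then exhaustively choose an outermost occurrence of $QU.D$ ($Q\in\{\exists,\forall,\le n,\ge n\}$) with $D$ not a concept name, replace it by $QU.F$ ($F$ fresh concept name), and add $\neg F\sqcup D$ if $Q\in\{\exists,\forall,\ge n\}$, resp. $\mathrm{NNF}(\neg D)\sqcup F$ if $Q=\le n$. $\mathrm{Ege}(\mathcal K)$: starting from $\mathrm{FLAT}(\mathcal K)$, repeat until no $\ge$ restriction remains: choose an occurrence of $\ge n\,U.A$ in a TBox axiom; replace it by $\exists R_1.A\sqcap\dots\sqcap\exists R_n.A$ with fresh role names $R_1,\dots,R_n$; add RBox axioms $R_i\sqsubseteq U$ for $1\le i\le n$; add TBox axioms $\forall(R_i\sqcap R_k).\bot$ for $1\le i<k\le n$. -}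

module Defs where

open import Level using (0ℓ)
open import Data.Nat using (ℕ; zero; suc)
open import Data.Fin using (Fin; zero; suc)
open import Data.List using (List; []; _∷_; _++_; map; concatMap; allFin)
open import Data.List.Membership.Propositional using (_∉_)
open import Data.List.Relation.Unary.All using (All)
open import Data.Bool using (Bool; true; false; not; _∧_; _∨_)
open import Data.Product using (Σ; _×_; _,_)
open import Data.Sum using (_⊎_)
open import Data.Empty using (⊥)
open import Data.Unit using (⊤)
open import Function using (_∘_)
open import Relation.Nullary using (¬_)
open import Relation.Binary.PropositionalEquality using (_≡_)
open import Relation.Binary.Construct.Closure.ReflexiveTransitive using (Star)

-- Names: N_C, N_R, N_I are each represented by ℕ (disjoint namespaces,
-- countably infinitely many names, so fresh names always exist).

data Role : Set where
  rn  : ℕ → Role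
  inv : ℕ → Role

Inv : Role → Role
Inv (rn R)  = inv R
Inv (inv R) = rn R

data RExp : Set where
  at   : Role → RExp
  rnot : RExp → RExp
  rand : RExp → RExp → RExp
  ror  : RExp → RExp → RExp

-- S ⊢ U : U is true when exactly the atomic roles in S (given by its
-- characteristic function) are true
_⊢_ : (Role → Bool) → RExp → Bool
S ⊢ at r     = S r
S ⊢ rnot U   = not (S ⊢ U)
S ⊢ rand U V = (S ⊢ U) ∧ (S ⊢ V)
S ⊢ ror U V  = (S ⊢ U) ∨ (S ⊢ V)

Restricted : RExp → Set
Restricted U = ((λ _ → false) ⊢ U) ≡ false

-- Concepts.  atMost n S C is (≤ n S.C);  atLeastSuc n S C is (≥ (n+1) S.C).
data Concept : Set where
  cn         : ℕ → Concept
  top        : Concept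
  bot        : Concept
  neg        : Concept → Concept
  _⊓_        : Concept → Concept → Concept
  _⊔_        : Concept → Concept → Concept
  allR       : RExp → Concept → Concept
  exR        : RExp → Concept → Concept
  atMost     : ℕ → Role → Concept → Concept
  atLeastSuc : ℕ → Role → Concept → Concept

infixr 7 _⊓_
infixr 6 _⊔_

data Term : Set where
  var : ℕ → Term
  ind : ℕ → Term

data Atom : Set where
  cAtom  : ℕ → Term → Atom
  rAtom  : ℕ → Term → Term → Atom
  eqAtom : Term → Term → Atom

record Rule : Set where
  constructor _⇒_
  field
    body : List Atom
    head : List Atom

data RAx : Set where
  _⊑_ : RExp → RExp → RAx

-- Knowledge bases: TBox axioms are stored as concepts (C ⊑ D as ¬C ⊔ D)
record KB : Set where
  constructor kb
  field
    tbox  : List Concept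
    rbox  : List RAx
    rules : List Rule

open KB public

record Interp : Set₁ where
  field
    Δ     : Set
    elem  : Δ
    conI  : ℕ → Δ → Set
    roleI : ℕ → Δ → Δ → Set
    indI  : ℕ → Δ

module Sem (I : Interp) where
  open Interp I

  ⟦_⟧r : Role → Δ → Δ → Set
  ⟦ rn R ⟧r x y  = roleI R x y
  ⟦ inv R ⟧r x y = roleI R y x

  ⟦_⟧u : RExp → Δ → Δ → Set
  ⟦ at r ⟧u x y     = ⟦ r ⟧r x y
  ⟦ rnot U ⟧u x y   = ¬ ⟦ U ⟧u x y
  ⟦ rand U V ⟧u x y = ⟦ U ⟧u x y × ⟦ V ⟧u x y
  ⟦ ror U V ⟧u x y  = ⟦ U ⟧u x y ⊎ ⟦ V ⟧u x y

  AtLeast : ℕ → (Δ → Set) → Set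
  AtLeast m P = Σ (Fin m → Δ) λ f → (∀ i j → f i ≡ f j → i ≡ j) × (∀ i → P (f i))

  ⟦_⟧c : Concept → Δ → Set
  ⟦ cn A ⟧c x             = conI A x
  ⟦ top ⟧c x              = ⊤
  ⟦ bot ⟧c x              = ⊥
  ⟦ neg C ⟧c x            = ¬ ⟦ C ⟧c x
  ⟦ C ⊓ D ⟧c x            = ⟦ C ⟧c x × ⟦ D ⟧c x
  ⟦ C ⊔ D ⟧c x            = ⟦ C ⟧c x ⊎ ⟦ D ⟧c x
  ⟦ allR U C ⟧c x         = ∀ y → ⟦ U ⟧u x y → ⟦ C ⟧c y
  ⟦ exR U C ⟧c x          = Σ Δ λ y → ⟦ U ⟧u x y × ⟦ C ⟧c y
  ⟦ atMost n S C ⟧c x     = ¬ AtLeast (suc n) (λ y → ⟦ S ⟧r x y × ⟦ C ⟧c y)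
  ⟦ atLeastSuc n S C ⟧c x = AtLeast (suc n) (λ y → ⟦ S ⟧r x y × ⟦ C ⟧c y)

  Named : Δ → Set
  Named x = Σ ℕ λ a → indI a ≡ x

  term : (ℕ → Δ) → Term → Δ
  term σ (var v) = σ v
  term σ (ind a) = indI a

  AtomSat : (ℕ → Δ) → Atom → Set
  AtomSat σ (cAtom A t)   = conI A (term σ t)
  AtomSat σ (rAtom R t u) = roleI R (term σ t) (term σ u)
  AtomSat σ (eqAtom t u)  = term σ t ≡ term σ u

  HeadSat : (ℕ → Δ) → List Atom → Set
  HeadSat σ []       = ⊥
  HeadSat σ (h ∷ hs) = All (AtomSat σ) (h ∷ hs)

  RuleSat : Rule → Set
  RuleSat (B ⇒ H) = (σ : ℕ → Δ) → (∀ v → Named (σ v)) → All (AtomSat σ) B → HeadSat σ H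

  RAxSat : RAx → Set
  RAxSat (U ⊑ V) = ∀ x y → ⟦ U ⟧u x y → ⟦ V ⟧u x y

  AxSat : Concept → Set
  AxSat C = ∀ x → ⟦ C ⟧c x

  Models : KB → Set
  Models K = All AxSat (tbox K) × All RAxSat (rbox K) × All RuleSat (rules K)

Satisfiable : KB → Set₁
Satisfiable K = Σ Interp λ I → Sem.Models I K

WFC : Concept → Set
WFC (cn A)             = ⊤
WFC top                = ⊤
WFC bot                = ⊤
WFC (neg C)            = WFC C
WFC (C ⊓ D)            = WFC C × WFC D
WFC (C ⊔ D)            = WFC C × WFC D
WFC (allR U C)         = Restricted U × WFC C
WFC (exR U C)          = Restricted U × WFC C
WFC (atMost n S C)     = WFC C
WFC (atLeastSuc n S C) = WFC C

WFRAx : RAx → Set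
WFRAx (U ⊑ V) = Restricted U × Restricted V

WFKB : KB → Set
WFKB K = All WFC (tbox K) × All WFRAx (rbox K)

IsNNF : Concept → Set
IsNNF (cn A)             = ⊤
IsNNF top                = ⊤
IsNNF bot                = ⊤
IsNNF (neg (cn A))       = ⊤
IsNNF (neg _)            = ⊥
IsNNF (C ⊓ D)            = IsNNF C × IsNNF D
IsNNF (C ⊔ D)            = IsNNF C × IsNNF D
IsNNF (allR U C)         = IsNNF C
IsNNF (exR U C)          = IsNNF C
IsNNF (atMost n S C)     = IsNNF C
IsNNF (atLeastSuc n S C) = IsNNF C

NoGe : Concept → Set
NoGe (cn A)             = ⊤
NoGe top                = ⊤
NoGe bot                = ⊤
NoGe (neg C)            = NoGe C
NoGe (C ⊓ D)            = NoGe C × NoGe D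
NoGe (C ⊔ D)            = NoGe C × NoGe D
NoGe (allR U C)         = NoGe C
NoGe (exR U C)          = NoGe C
NoGe (atMost n S C)     = NoGe C
NoGe (atLeastSuc n S C) = ⊥

NoGeKB : KB → Set
NoGeKB K = All NoGe (tbox K)

IsALCHIbLe : KB → Set
IsALCHIbLe K = WFKB K × All (λ C → IsNNF C × NoGe C) (tbox K)

cnamesC : Concept → List ℕ
cnamesC (cn A)             = A ∷ []
cnamesC top                = []
cnamesC bot                = []
cnamesC (neg C)            = cnamesC C
cnamesC (C ⊓ D)            = cnamesC C ++ cnamesC D
cnamesC (C ⊔ D)            = cnamesC C ++ cnamesC D
cnamesC (allR U C)         = cnamesC C
cnamesC (exR U C)          = cnamesC C
cnamesC (atMost n S C)     = cnamesC C
cnamesC (atLeastSuc n S C) = cnamesC C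

rnameRole : Role → ℕ
rnameRole (rn R)  = R
rnameRole (inv R) = R

rnamesU : RExp → List ℕ
rnamesU (at r)     = rnameRole r ∷ []
rnamesU (rnot U)   = rnamesU U
rnamesU (rand U V) = rnamesU U ++ rnamesU V
rnamesU (ror U V)  = rnamesU U ++ rnamesU V

rnamesC : Concept → List ℕ
rnamesC (cn A)             = []
rnamesC top                = []
rnamesC bot                = []
rnamesC (neg C)            = rnamesC C
rnamesC (C ⊓ D)            = rnamesC C ++ rnamesC D
rnamesC (C ⊔ D)            = rnamesC C ++ rnamesC D
rnamesC (allR U C)         = rnamesU U ++ rnamesC C
rnamesC (exR U C)          = rnamesU U ++ rnamesC C
rnamesC (atMost n S C)     = rnameRole S ∷ rnamesC C
rnamesC (atLeastSuc n S C) = rnameRole S ∷ rnamesC C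

rnamesRAx : RAx → List ℕ
rnamesRAx (U ⊑ V) = rnamesU U ++ rnamesU V

cnamesAtom : Atom → List ℕ
cnamesAtom (cAtom A t)   = A ∷ []
cnamesAtom (rAtom R t u) = []
cnamesAtom (eqAtom t u)  = []

rnamesAtom : Atom → List ℕ
rnamesAtom (cAtom A t)   = []
rnamesAtom (rAtom R t u) = R ∷ []
rnamesAtom (eqAtom t u)  = []

ruleAtoms : Rule → List Atom
ruleAtoms (B ⇒ H) = B ++ H

conceptNames : KB → List ℕ
conceptNames K = concatMap cnamesC (tbox K) ++ concatMap cnamesAtom (concatMap ruleAtoms (rules K))

roleNames : KB → List ℕ
roleNames K = concatMap rnamesC (tbox K) ++ concatMap rnamesRAx (rbox K)
              ++ concatMap rnamesAtom (concatMap ruleAtoms (rules K))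

mutual
  nnf : Concept → Concept
  nnf (cn A)             = cn A
  nnf top                = top
  nnf bot                = bot
  nnf (neg C)            = nnfNeg C
  nnf (C ⊓ D)            = nnf C ⊓ nnf D
  nnf (C ⊔ D)            = nnf C ⊔ nnf D
  nnf (allR U C)         = allR U (nnf C)
  nnf (exR U C)          = exR U (nnf C)
  nnf (atMost n S C)     = atMost n S (nnf C)
  nnf (atLeastSuc n S C) = atLeastSuc n S (nnf C)

  nnfNeg : Concept → Concept
  nnfNeg (cn A)             = neg (cn A)
  nnfNeg top                = bot
  nnfNeg bot                = top
  nnfNeg (neg C)            = nnf C
  nnfNeg (C ⊓ D)            = nnfNeg C ⊔ nnfNeg D
  nnfNeg (C ⊔ D)            = nnfNeg C ⊓ nnfNeg D
  nnfNeg (allR U C)         = exR U (nnfNeg C)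
  nnfNeg (exR U C)          = allR U (nnfNeg C)
  nnfNeg (atMost n S C)     = atLeastSuc n S (nnf C)
  nnfNeg (atLeastSuc n S C) = atMost n S (nnf C)

data Ctx : Set where
  ∙       : Ctx
  negC    : Ctx → Ctx
  andL    : Ctx → Concept → Ctx
  andR    : Concept → Ctx → Ctx
  orL     : Ctx → Concept → Ctx
  orR     : Concept → Ctx → Ctx
  allC    : RExp → Ctx → Ctx
  exC     : RExp → Ctx → Ctx
  atMostC : ℕ → Role → Ctx → Ctx
  atLeastSucC : ℕ → Role → Ctx → Ctx

plug : Ctx → Concept → Concept
plug ∙ E                   = E
plug (negC c) E            = neg (plug c E)
plug (andL c D) E          = plug c E ⊓ D
plug (andR C c) E          = C ⊓ plug c E
plug (orL c D) E           = plug c E ⊔ D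
plug (orR C c) E           = C ⊔ plug c E
plug (allC U c) E          = allR U (plug c E)
plug (exC U c) E           = exR U (plug c E)
plug (atMostC n S c) E     = atMost n S (plug c E)
plug (atLeastSucC n S c) E = atLeastSuc n S (plug c E)

-- the hole is not below any quantifier/number restriction: exactly the
-- positions of outermost occurrences of QU.D
data BoolCtx : Ctx → Set where
  ∙    : BoolCtx ∙
  negC : ∀ {c} → BoolCtx c → BoolCtx (negC c)
  andL : ∀ {c D} → BoolCtx c → BoolCtx (andL c D)
  andR : ∀ {C c} → BoolCtx c → BoolCtx (andR C c)
  orL  : ∀ {c D} → BoolCtx c → BoolCtx (orL c D)
  orR  : ∀ {C c} → BoolCtx c → BoolCtx (orR C c)

data Quant : Set where
  qall : RExp → Quant
  qex  : RExp → Quant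
  qle  : ℕ → Role → Quant
  qge  : ℕ → Role → Quant

mkQ : Quant → Concept → Concept
mkQ (qall U) D  = allR U D
mkQ (qex U) D   = exR U D
mkQ (qle n S) D = atMost n S D
mkQ (qge n S) D = atLeastSuc n S D

newAx : Quant → ℕ → Concept → Concept
newAx (qle n S) F D = nnf (neg D) ⊔ cn F
newAx (qall U) F D  = neg (cn F) ⊔ D
newAx (qex U) F D   = neg (cn F) ⊔ D
newAx (qge n S) F D = neg (cn F) ⊔ D

IsName : Concept → Set
IsName D = Σ ℕ λ A → D ≡ cn A

nnfKB : KB → KB
nnfKB (kb T R P) = kb (map nnf T) R P

data FlatStep : KB → KB → Set where
  flatStep : ∀ {R P} (pre post : List Concept) (c : Ctx) (q : Quant) (D : Concept) (F : ℕ)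
    → BoolCtx c → ¬ IsName D
    → F ∉ conceptNames (kb (pre ++ plug c (mkQ q D) ∷ post) R P)
    → FlatStep (kb (pre ++ plug c (mkQ q D) ∷ post) R P)
               (kb (pre ++ plug c (mkQ q (cn F)) ∷ post ++ newAx q F D ∷ []) R P)

-- FLAT K K' : K' is a possible result of FLAT(K) (any choice of occurrences
-- and fresh names), i.e. obtained by exhaustive application of the step
FLAT : KB → KB → Set
FLAT K K' = Star FlatStep (nnfKB K) K' × (∀ K'' → ¬ FlatStep K' K'')

exConj : ∀ n → (Fin (suc n) → ℕ) → ℕ → Concept
exConj zero rs A    = exR (at (rn (rs zero))) (cn A)
exConj (suc n) rs A = exR (at (rn (rs zero))) (cn A) ⊓ exConj n (rs ∘ suc) A

disjAx : ∀ n → (Fin (suc n) → ℕ) → List Concept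
disjAx zero rs    = []
disjAx (suc n) rs =
  map (λ j → allR (rand (at (rn (rs zero))) (at (rn (rs (suc j))))) bot) (allFin (suc n))
  ++ disjAx n (rs ∘ suc)

subAx : ∀ n → (Fin (suc n) → ℕ) → Role → List RAx
subAx n rs S = map (λ i → at (rn (rs i)) ⊑ at S) (allFin (suc n))

data EgeStep : KB → KB → Set where
  egeStep : ∀ {R P} (pre post : List Concept) (c : Ctx) (n : ℕ) (S : Role) (A : ℕ)
    (rs : Fin (suc n) → ℕ)
    → (∀ i j → rs i ≡ rs j → i ≡ j)
    → (∀ i → rs i ∉ roleNames (kb (pre ++ plug c (atLeastSuc n S (cn A)) ∷ post) R P))
    → EgeStep (kb (pre ++ plug c (atLeastSuc n S (cn A)) ∷ post) R P)
              (kb (pre ++ plug c (exConj n rs A) ∷ post ++ disjAx n rs)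
                  (R ++ subAx n rs S) P)

Ege : KB → KB → Set
Ege K K' = Σ KB λ K₁ → FLAT K K₁ × Star EgeStep K₁ K' × NoGeKB K'

-- In negation normal form every restriction QU.D that is not nested in another restriction occurs
-- positively (under ⊓ and ⊔ only), so replacing it by a concept that implies it preserves models.
-- A FLAT step replaces D by a fresh name F together with F ⊑ D (D ⊑ F for ≤, which is antitone in
-- its filler): backwards the new axiom turns QU.F into QU.D, forwards a model is extended by
-- interpreting F as D. After exhaustive flattening all fillers are names, so every ≥ occurs
-- positively at Boolean level. An Ege step replaces ≥(n+1)S.A by ∃R₀.A ⊓ … ⊓ ∃Rₙ.A with pairwise
-- disjoint Rᵢ ⊑ S: the distinct witnesses give back ≥(n+1)S.A, and conversely Rᵢ is interpreted as
-- "is the i-th member of a fixed family of n+1 distinct S-successors in A", chosen classically.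
-- Freshness of F and of the Rᵢ leaves the meaning of the rest of the knowledge base unchanged.

module Submission where

open import Defs
open import Level using (0ℓ)
open import Axiom.ExcludedMiddle using (ExcludedMiddle)
open import Data.Nat using (ℕ; zero; suc)
open import Data.Nat.Properties using (<-irrefl)
open import Data.List.Extrema.Nat using (max; xs≤max)
open import Data.Fin using (Fin; zero; suc)
open import Data.Fin.Properties using (suc-injective) renaming (_≟_ to _≟ᶠ_)
open import Data.List using (List; []; _∷_; _++_; concatMap; map; allFin)
open import Data.List.Relation.Unary.All as All using (All; []; _∷_)
open import Data.List.Relation.Unary.All.Properties
  using (++⁻ˡ; ++⁻ʳ; ++⁻; ++⁺; concat⁻; map⁻; map⁺; tabulate⁺; tabulate⁻; ¬Any⇒All¬)
open import Data.List.Relation.Unary.Any using (here; there)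
import Data.List.Relation.Unary.Any.Properties as Anyₚ
open import Data.List.Membership.Propositional using (_∈_; _∉_)
open import Data.List.Membership.Propositional.Properties using (∈-++⁺ˡ; ∈-++⁺ʳ; ∈-concatMap⁺; ∈-∃++)
open import Data.List.Relation.Binary.Subset.Propositional using (_⊆_)
open import Data.Product using (Σ; _×_; _,_; proj₁; proj₂; zip′)
open import Data.Product.Function.NonDependent.Propositional using (_×-⇔_)
open import Data.Product.Function.Dependent.Propositional using (Σ-⇔)
open import Data.Sum as Sum using (_⊎_; inj₁; inj₂; [_,_])
open import Data.Sum.Function.Propositional using (_⊎-⇔_)
open import Data.Empty using (⊥; ⊥-elim)
open import Data.Unit using (⊤; tt)
open import Function using (_∘_; id)
open import Function.Bundles using (_⇔_; mk⇔; Equivalence)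
open import Function.Construct.Identity using (⇔-id; ↠-id)
open import Function.Construct.Symmetry using (⇔-sym)
open import Function.Properties.Equivalence using () renaming (trans to ⇔-trans)
open import Function.Related.TypeIsomorphisms using (→-cong-⇔; ¬-cong-⇔)
open import Relation.Binary.Construct.Closure.ReflexiveTransitive as Star using (Star)
open import Relation.Nullary using (¬_; Dec; yes; no)
open import Relation.Nullary.Decidable using (decidable-stable)
open import Relation.Binary.PropositionalEquality using (_≡_; refl; sym; trans; cong; subst; _≢_)

open Equivalence using (to; from)

Π-cong-⇔ : {A : Set} {P Q : A → Set} → (∀ a → P a ⇔ Q a) → (∀ a → P a) ⇔ (∀ a → Q a)
Π-cong-⇔ h = mk⇔ (λ f a → to (h a) (f a)) (λ g a → from (h a) (g a))

∃-cong-⇔ : {A : Set} {P Q : A → Set} → (∀ a → P a ⇔ Q a) → Σ A P ⇔ Σ A Q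
∃-cong-⇔ h = Σ-⇔ (↠-id _) (λ {a} → h a)

concatMap⁻ : ∀ {A B : Set} {P : B → Set} (f : A → List B) xs →
             All P (concatMap f xs) → All (All P ∘ f) xs
concatMap⁻ f xs = map⁻ ∘ concat⁻

All-map-allFin : ∀ {A : Set} {P : A → Set} {m} (g : Fin m → A) → All P (map g (allFin m)) ⇔ (∀ i → P (g i))
All-map-allFin g = mk⇔ (tabulate⁻ {f = id} ∘ map⁻) (map⁺ ∘ tabulate⁺ {f = id})

module _ {A : Set} {P : A → Set} where

  All-focus : ∀ pre {x post} → All P (pre ++ x ∷ post) → P x
  All-focus pre ps with ++⁻ pre ps
  ... | _ , (px ∷ _) = px

  All-splice : ∀ pre {x x′ post new} → All P (pre ++ x ∷ post) → (P x → P x′) → All P new →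
               All P (pre ++ x′ ∷ post ++ new)
  All-splice pre ps f pnew with ++⁻ pre ps
  ... | ppre , (px ∷ ppost) = ++⁺ ppre (f px ∷ ++⁺ ppost pnew)

  All-unsplice : ∀ pre {x x′ post new} → All P (pre ++ x′ ∷ post ++ new) → (All P new → P x′ → P x) →
                 All P (pre ++ x ∷ post)
  All-unsplice pre {post = post} ps f with ++⁻ pre ps
  ... | ppre , (px′ ∷ rest) with ++⁻ post rest
  ... | ppost , pnew = ++⁺ ppre (f pnew px′ ∷ ppost)

module _ (I : Interp) where
  open Interp I
  open Sem I

  AtLeast-map : ∀ {m} {P Q : Δ → Set} → (∀ y → P y → Q y) → AtLeast m P → AtLeast m Q
  AtLeast-map h (f , f-injective , p) = f , f-injective , λ i → h (f i) (p i)

  AtLeast-cong : ∀ {m} {P Q : Δ → Set} → (∀ y → P y ⇔ Q y) → AtLeast m P ⇔ AtLeast m Q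
  AtLeast-cong h = mk⇔ (AtLeast-map (to ∘ h)) (AtLeast-map (from ∘ h))

-- Coincidence of interpretations on the names of a knowledge base

reinterpret : (I : Interp) → (ℕ → Interp.Δ I → Set) → (ℕ → Interp.Δ I → Interp.Δ I → Set) → Interp
reinterpret I conI′ roleI′ = record I { conI = conI′ ; roleI = roleI′ }

module Coincidence (I : Interp) (conI′ : ℕ → Interp.Δ I → Set)
                   (roleI′ : ℕ → Interp.Δ I → Interp.Δ I → Set) where
  open Interp I
  open Sem I
  private
    J = reinterpret I conI′ roleI′
    module J = Sem J

  SameConcept : ℕ → Set
  SameConcept A = ∀ x → conI A x ⇔ conI′ A x

  SameRole : ℕ → Set
  SameRole R = ∀ x y → roleI R x y ⇔ roleI′ R x y

  ⟦⟧r-agree : ∀ r → SameRole (rnameRole r) → ∀ x y → ⟦ r ⟧r x y ⇔ J.⟦ r ⟧r x y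
  ⟦⟧r-agree (rn R)  h x y = h x y
  ⟦⟧r-agree (inv R) h x y = h y x

  ⟦⟧u-agree : ∀ U → All SameRole (rnamesU U) → ∀ x y → ⟦ U ⟧u x y ⇔ J.⟦ U ⟧u x y
  ⟦⟧u-agree (at r)     (h ∷ []) = ⟦⟧r-agree r h
  ⟦⟧u-agree (rnot U)   h x y = ¬-cong-⇔ (⟦⟧u-agree U h x y)
  ⟦⟧u-agree (rand U V) h x y = ⟦⟧u-agree U (++⁻ˡ _ h) x y ×-⇔ ⟦⟧u-agree V (++⁻ʳ _ h) x y
  ⟦⟧u-agree (ror U V)  h x y = ⟦⟧u-agree U (++⁻ˡ _ h) x y ⊎-⇔ ⟦⟧u-agree V (++⁻ʳ _ h) x y

  ⟦⟧c-agree : ∀ C → All SameConcept (cnamesC C) → All SameRole (rnamesC C) →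
              ∀ x → ⟦ C ⟧c x ⇔ J.⟦ C ⟧c x
  ⟦⟧c-agree (cn A) (h ∷ []) _ = h
  ⟦⟧c-agree top _ _ _ = ⇔-id _
  ⟦⟧c-agree bot _ _ _ = ⇔-id _
  ⟦⟧c-agree (neg C) hc hr x = ¬-cong-⇔ (⟦⟧c-agree C hc hr x)
  ⟦⟧c-agree (C ⊓ D) hc hr x =
    ⟦⟧c-agree C (++⁻ˡ _ hc) (++⁻ˡ _ hr) x ×-⇔ ⟦⟧c-agree D (++⁻ʳ _ hc) (++⁻ʳ _ hr) x
  ⟦⟧c-agree (C ⊔ D) hc hr x =
    ⟦⟧c-agree C (++⁻ˡ _ hc) (++⁻ˡ _ hr) x ⊎-⇔ ⟦⟧c-agree D (++⁻ʳ _ hc) (++⁻ʳ _ hr) x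
  ⟦⟧c-agree (allR U C) hc hr x = Π-cong-⇔ λ y →
    →-cong-⇔ (⟦⟧u-agree U (++⁻ˡ _ hr) x y) (⟦⟧c-agree C hc (++⁻ʳ _ hr) y)
  ⟦⟧c-agree (exR U C) hc hr x = ∃-cong-⇔ λ y →
    ⟦⟧u-agree U (++⁻ˡ _ hr) x y ×-⇔ ⟦⟧c-agree C hc (++⁻ʳ _ hr) y
  ⟦⟧c-agree (atMost n S C) hc (hS ∷ hr) x = ¬-cong-⇔ (AtLeast-cong I λ y →
    ⟦⟧r-agree S hS x y ×-⇔ ⟦⟧c-agree C hc hr y)
  ⟦⟧c-agree (atLeastSuc n S C) hc (hS ∷ hr) x = AtLeast-cong I λ y →
    ⟦⟧r-agree S hS x y ×-⇔ ⟦⟧c-agree C hc hr y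

  SameAtom : Atom → Set
  SameAtom a = All SameConcept (cnamesAtom a) × All SameRole (rnamesAtom a)

  term-agree : ∀ σ t → J.term σ t ≡ term σ t
  term-agree σ (var v) = refl
  term-agree σ (ind a) = refl

  AtomSat-agree : ∀ σ a → SameAtom a → AtomSat σ a ⇔ J.AtomSat σ a
  AtomSat-agree σ (cAtom A t) (h ∷ [] , _) rewrite term-agree σ t = h (term σ t)
  AtomSat-agree σ (rAtom R t u) (_ , h ∷ []) rewrite term-agree σ t | term-agree σ u =
    h (term σ t) (term σ u)
  AtomSat-agree σ (eqAtom t u) _ rewrite term-agree σ t | term-agree σ u = ⇔-id _

  RuleSat-agree : ∀ ρ → All SameAtom (ruleAtoms ρ) → RuleSat ρ → J.RuleSat ρ
  RuleSat-agree (B ⇒ H) same sat σ named body =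
    head-agree H (++⁻ʳ B same) (sat σ named (body-agree (++⁻ˡ B same) body))
    where
    body-agree : ∀ {as} → All SameAtom as → All (J.AtomSat σ) as → All (AtomSat σ) as
    body-agree hs bs = All.zipWith (λ {a} (h , b) → from (AtomSat-agree σ a h) b) (hs , bs)

    head-agree : ∀ as → All SameAtom as → HeadSat σ as → J.HeadSat σ as
    head-agree (a ∷ as) hs sats = All.zipWith (λ {b} (h , s) → to (AtomSat-agree σ b h) s) (hs , sats)

  Models-agree : ∀ K → All SameConcept (conceptNames K) → All SameRole (roleNames K) →
                 Models K → J.Models K
  Models-agree (kb T R P) hc hr (mT , mR , mP) =
    All.zipWith (λ {C} → tbox-agree {C}) (sameT , mT) ,
    All.zipWith (λ {ax} → rbox-agree {ax}) (concatMap⁻ rnamesRAx R hrR , mR) ,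
    All.zipWith (λ {ρ} → rules-agree {ρ}) (concatMap⁻ ruleAtoms P sameAtoms , mP)
    where
    atoms = concatMap ruleAtoms P
    hrR = ++⁻ˡ _ (++⁻ʳ (concatMap rnamesC T) hr)

    SameNamesC : Concept → Set
    SameNamesC C = All SameConcept (cnamesC C) × All SameRole (rnamesC C)

    sameT : All SameNamesC T
    sameT = All.zip (concatMap⁻ cnamesC T (++⁻ˡ _ hc) , concatMap⁻ rnamesC T (++⁻ˡ _ hr))

    sameAtoms : All SameAtom atoms
    sameAtoms = All.zip (concatMap⁻ cnamesAtom atoms (++⁻ʳ (concatMap cnamesC T) hc) ,
                         concatMap⁻ rnamesAtom atoms
                           (++⁻ʳ (concatMap rnamesRAx R) (++⁻ʳ (concatMap rnamesC T) hr)))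

    tbox-agree : ∀ {C} → SameNamesC C × AxSat C → J.AxSat C
    tbox-agree {C} ((hcC , hrC) , sat) x = to (⟦⟧c-agree C hcC hrC x) (sat x)

    rbox-agree : ∀ {ax} → All SameRole (rnamesRAx ax) × RAxSat ax → J.RAxSat ax
    rbox-agree {U ⊑ V} (h , sat) x y u =
      to (⟦⟧u-agree V (++⁻ʳ _ h) x y) (sat x y (from (⟦⟧u-agree U (++⁻ˡ _ h) x y) u))

    rules-agree : ∀ {ρ} → All SameAtom (ruleAtoms ρ) × RuleSat ρ → J.RuleSat ρ
    rules-agree {ρ} (h , sat) = RuleSat-agree ρ h sat

data Positive : Ctx → Set where
  ∙    : Positive ∙
  andL : ∀ {c D} → Positive c → Positive (andL c D)
  andR : ∀ {C c} → Positive c → Positive (andR C c)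
  orL  : ∀ {c D} → Positive c → Positive (orL c D)
  orR  : ∀ {C c} → Positive c → Positive (orR C c)

module _ (I : Interp) where
  open Sem I

  plug-cong : ∀ c {E E′} → (∀ x → ⟦ E ⟧c x ⇔ ⟦ E′ ⟧c x) →
              ∀ x → ⟦ plug c E ⟧c x ⇔ ⟦ plug c E′ ⟧c x
  plug-cong ∙          h = h
  plug-cong (negC c)   h x = ¬-cong-⇔ (plug-cong c h x)
  plug-cong (andL c D) h x = plug-cong c h x ×-⇔ ⇔-id _
  plug-cong (andR C c) h x = ⇔-id _ ×-⇔ plug-cong c h x
  plug-cong (orL c D)  h x = plug-cong c h x ⊎-⇔ ⇔-id _
  plug-cong (orR C c)  h x = ⇔-id _ ⊎-⇔ plug-cong c h x
  plug-cong (allC U c) h x = Π-cong-⇔ λ y → →-cong-⇔ (⇔-id _) (plug-cong c h y)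
  plug-cong (exC U c)  h x = ∃-cong-⇔ λ y → ⇔-id _ ×-⇔ plug-cong c h y
  plug-cong (atMostC n S c) {E} {E′} h x =
    ¬-cong-⇔ (AtLeast-cong I λ y → ⇔-id (⟦ S ⟧r x y) ×-⇔ plug-cong c {E} {E′} h y)
  plug-cong (atLeastSucC n S c) {E} {E′} h x =
    AtLeast-cong I λ y → ⇔-id (⟦ S ⟧r x y) ×-⇔ plug-cong c {E} {E′} h y

  plug-mono : ∀ {c} → Positive c → ∀ {E E′} → (∀ x → ⟦ E ⟧c x → ⟦ E′ ⟧c x) →
              ∀ x → ⟦ plug c E ⟧c x → ⟦ plug c E′ ⟧c x
  plug-mono ∙         h = h
  plug-mono (andL pc) h x (a , b) = plug-mono pc h x a , b
  plug-mono (andR pc) h x (a , b) = a , plug-mono pc h x b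
  plug-mono (orL pc)  h x = Sum.map₁ (plug-mono pc h x)
  plug-mono (orR pc)  h x = Sum.map₂ (plug-mono pc h x)

  atLeastSuc-mono : ∀ n S {C D} → (∀ y → ⟦ C ⟧c y → ⟦ D ⟧c y) →
                    ∀ x → ⟦ atLeastSuc n S C ⟧c x → ⟦ atLeastSuc n S D ⟧c x
  atLeastSuc-mono n S {C} {D} h x =
    AtLeast-map I {P = λ y → ⟦ S ⟧r x y × ⟦ C ⟧c y} {Q = λ y → ⟦ S ⟧r x y × ⟦ D ⟧c y}
                  λ y (s , c) → s , h y c

  atMost-antitone : ∀ n S {C D} → (∀ y → ⟦ C ⟧c y → ⟦ D ⟧c y) →
                    ∀ x → ⟦ atMost n S D ⟧c x → ⟦ atMost n S C ⟧c x
  atMost-antitone n S {C} {D} h x ¬atl = ¬atl ∘ atLeastSuc-mono n S {C} {D} h x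

  mkQ-cong : ∀ q {D D′} → (∀ x → ⟦ D ⟧c x ⇔ ⟦ D′ ⟧c x) →
             ∀ x → ⟦ mkQ q D ⟧c x ⇔ ⟦ mkQ q D′ ⟧c x
  mkQ-cong (qall U) {D} {D′} = plug-cong (allC U ∙) {D} {D′}
  mkQ-cong (qex U) {D} {D′} = plug-cong (exC U ∙) {D} {D′}
  mkQ-cong (qle n S) {D} {D′} = plug-cong (atMostC n S ∙) {D} {D′}
  mkQ-cong (qge n S) {D} {D′} = plug-cong (atLeastSucC n S ∙) {D} {D′}

-- Negation normal form

¬⊎⇔¬×¬ : {A B : Set} → (¬ (A ⊎ B)) ⇔ (¬ A × ¬ B)
¬⊎⇔¬×¬ = mk⇔ (λ h → h ∘ inj₁ , h ∘ inj₂) (λ (¬a , ¬b) → [ ¬a , ¬b ])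

¬∃⇔∀¬ : {A : Set} {P Q : A → Set} → (¬ Σ A (λ a → P a × Q a)) ⇔ (∀ a → P a → ¬ Q a)
¬∃⇔∀¬ = mk⇔ (λ h a p q → h (a , p , q)) (λ h (a , p , q) → h a p q)

module Classical (em : ExcludedMiddle 0ℓ) where

  stable : {A : Set} → ¬ ¬ A → A
  stable = decidable-stable em

  ¬¬⇔ : {A : Set} → (¬ ¬ A) ⇔ A
  ¬¬⇔ = mk⇔ stable (λ a ¬a → ¬a a)

  ¬×⇔¬⊎¬ : {A B : Set} → (¬ (A × B)) ⇔ (¬ A ⊎ ¬ B)
  ¬×⇔¬⊎¬ {A} = mk⇔ split [ (λ ¬a (a , _) → ¬a a) , (λ ¬b (_ , b) → ¬b b) ]
    where
    split : ∀ {B} → ¬ (A × B) → ¬ A ⊎ ¬ B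
    split ¬ab with em {A}
    ... | yes a = inj₂ (λ b → ¬ab (a , b))
    ... | no ¬a = inj₁ ¬a

  ¬∀⇔∃¬ : {A : Set} {P Q : A → Set} → (¬ (∀ a → P a → Q a)) ⇔ Σ A (λ a → P a × ¬ Q a)
  ¬∀⇔∃¬ = mk⇔ (λ h → stable λ ¬∃ → h λ a p → stable λ ¬q → ¬∃ (a , p , ¬q))
              (λ (a , p , ¬q) h → ¬q (h a p))

  module _ (I : Interp) where
    open Sem I

    mutual
      nnf-sound : ∀ C x → ⟦ nnf C ⟧c x ⇔ ⟦ C ⟧c x
      nnf-sound (cn A)  x = ⇔-id _
      nnf-sound top     x = ⇔-id _
      nnf-sound bot     x = ⇔-id _
      nnf-sound (neg C) x = nnfNeg-sound C x
      nnf-sound (C ⊓ D) x = nnf-sound C x ×-⇔ nnf-sound D x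
      nnf-sound (C ⊔ D) x = nnf-sound C x ⊎-⇔ nnf-sound D x
      nnf-sound (allR U C)         = plug-cong I (allC U ∙) {nnf C} {C} (nnf-sound C)
      nnf-sound (exR U C)          = plug-cong I (exC U ∙) {nnf C} {C} (nnf-sound C)
      nnf-sound (atMost n S C)     = plug-cong I (atMostC n S ∙) {nnf C} {C} (nnf-sound C)
      nnf-sound (atLeastSuc n S C) = plug-cong I (atLeastSucC n S ∙) {nnf C} {C} (nnf-sound C)

      nnfNeg-sound : ∀ C x → ⟦ nnfNeg C ⟧c x ⇔ (¬ ⟦ C ⟧c x)
      nnfNeg-sound (cn A)  x = ⇔-id _
      nnfNeg-sound top     x = mk⇔ (λ ()) (λ ¬⊤ → ¬⊤ tt)
      nnfNeg-sound bot     x = mk⇔ (λ _ ()) (λ _ → tt)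
      nnfNeg-sound (neg C) x = ⇔-trans (nnf-sound C x) (⇔-sym ¬¬⇔)
      nnfNeg-sound (C ⊓ D) x = ⇔-trans (nnfNeg-sound C x ⊎-⇔ nnfNeg-sound D x) (⇔-sym ¬×⇔¬⊎¬)
      nnfNeg-sound (C ⊔ D) x = ⇔-trans (nnfNeg-sound C x ×-⇔ nnfNeg-sound D x) (⇔-sym ¬⊎⇔¬×¬)
      nnfNeg-sound (allR U C) x =
        ⇔-trans (∃-cong-⇔ λ y → ⇔-id _ ×-⇔ nnfNeg-sound C y) (⇔-sym ¬∀⇔∃¬)
      nnfNeg-sound (exR U C) x =
        ⇔-trans (Π-cong-⇔ λ y → →-cong-⇔ (⇔-id _) (nnfNeg-sound C y)) (⇔-sym ¬∃⇔∀¬)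
      nnfNeg-sound (atMost n S C) x =
        ⇔-trans (plug-cong I (atLeastSucC n S ∙) {nnf C} {C} (nnf-sound C) x) (⇔-sym ¬¬⇔)
      nnfNeg-sound (atLeastSuc n S C) = plug-cong I (atMostC n S ∙) {nnf C} {C} (nnf-sound C)

    Models-nnfKB : ∀ K → Models (nnfKB K) ⇔ Models K
    Models-nnfKB (kb T R P) = mk⇔
      (λ (mT , mR , mP) → All.map (λ {C} sat x → to (nnf-sound C x) (sat x)) (map⁻ mT) , mR , mP)
      (λ (mT , mR , mP) → map⁺ (All.map (λ {C} sat x → from (nnf-sound C x) (sat x)) mT) , mR , mP)

    -- `nnfNeg C ⊔ D` is the axiom C ⊑ D in negation normal form; `newAx` produces axioms of this shape.
    subsumption : ∀ {C D} → AxSat (nnfNeg C ⊔ D) → ∀ x → ⟦ C ⟧c x → ⟦ D ⟧c x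
    subsumption {C} ax x c = [ (λ ¬c → ⊥-elim (to (nnfNeg-sound C x) ¬c c)) , id ] (ax x)

    subsumption-complete : ∀ {C D} → (∀ x → ⟦ C ⟧c x → ⟦ D ⟧c x) → AxSat (nnfNeg C ⊔ D)
    subsumption-complete {C} h x with em {⟦ C ⟧c x}
    ... | yes c = inj₂ (h x c)
    ... | no ¬c = inj₁ (from (nnfNeg-sound C x) ¬c)

-- Syntactic invariants

Fillers : (Concept → Set) → Concept → Set
Fillers P (cn A)             = ⊤
Fillers P top                = ⊤
Fillers P bot                = ⊤
Fillers P (neg C)            = Fillers P C
Fillers P (C ⊓ D)            = Fillers P C × Fillers P D
Fillers P (C ⊔ D)            = Fillers P C × Fillers P D
Fillers P (allR U C)         = P C
Fillers P (exR U C)          = P C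
Fillers P (atMost n S C)     = P C
Fillers P (atLeastSuc n S C) = P C

Fillers-map : ∀ {P Q} → (∀ {C} → P C → Q C) → ∀ C → Fillers P C → Fillers Q C
Fillers-map f (cn A)             _ = tt
Fillers-map f top                _ = tt
Fillers-map f bot                _ = tt
Fillers-map f (neg C)            p = Fillers-map f C p
Fillers-map f (C ⊓ D)      (p , q) = Fillers-map f C p , Fillers-map f D q
Fillers-map f (C ⊔ D)      (p , q) = Fillers-map f C p , Fillers-map f D q
Fillers-map f (allR U C)         p = f p
Fillers-map f (exR U C)          p = f p
Fillers-map f (atMost n S C)     p = f p
Fillers-map f (atLeastSuc n S C) p = f p

IsName⇒NoGe : ∀ {C} → IsName C → NoGe C
IsName⇒NoGe (A , refl) = tt

IsNNF-neg⇒IsName : ∀ C → IsNNF (neg C) → IsName C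
IsNNF-neg⇒IsName (cn A) _ = A , refl
IsNNF-neg⇒IsName top                ()
IsNNF-neg⇒IsName bot                ()
IsNNF-neg⇒IsName (neg C)            ()
IsNNF-neg⇒IsName (C ⊓ D)            ()
IsNNF-neg⇒IsName (C ⊔ D)            ()
IsNNF-neg⇒IsName (allR U C)         ()
IsNNF-neg⇒IsName (exR U C)          ()
IsNNF-neg⇒IsName (atMost n S C)     ()
IsNNF-neg⇒IsName (atLeastSuc n S C) ()

plug-IsName : ∀ c {E} → IsName (plug c E) → IsName E
plug-IsName ∙                   p = p
plug-IsName (negC c)            (_ , ())
plug-IsName (andL c D)          (_ , ())
plug-IsName (andR C c)          (_ , ())
plug-IsName (orL c D)           (_ , ())
plug-IsName (orR C c)           (_ , ())
plug-IsName (allC U c)          (_ , ())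
plug-IsName (exC U c)           (_ , ())
plug-IsName (atMostC n S c)     (_ , ())
plug-IsName (atLeastSucC n S c) (_ , ())

mkQ-¬IsName : ∀ q {D} → ¬ IsName (mkQ q D)
mkQ-¬IsName (qall U)  (_ , ())
mkQ-¬IsName (qex U)   (_ , ())
mkQ-¬IsName (qle n S) (_ , ())
mkQ-¬IsName (qge n S) (_ , ())

BoolCtx∧IsNNF⇒Positive : ∀ {c E} → BoolCtx c → ¬ IsName E → IsNNF (plug c E) → Positive c
BoolCtx∧IsNNF⇒Positive ∙ _ _ = ∙
BoolCtx∧IsNNF⇒Positive {negC c} (negC _) ¬name nnf = ⊥-elim (¬name (plug-IsName c (IsNNF-neg⇒IsName _ nnf)))
BoolCtx∧IsNNF⇒Positive (andL b) ¬name (nnf , _) = andL (BoolCtx∧IsNNF⇒Positive b ¬name nnf)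
BoolCtx∧IsNNF⇒Positive (andR b) ¬name (_ , nnf) = andR (BoolCtx∧IsNNF⇒Positive b ¬name nnf)
BoolCtx∧IsNNF⇒Positive (orL b)  ¬name (nnf , _) = orL (BoolCtx∧IsNNF⇒Positive b ¬name nnf)
BoolCtx∧IsNNF⇒Positive (orR b)  ¬name (_ , nnf) = orR (BoolCtx∧IsNNF⇒Positive b ¬name nnf)

plug-ge-¬NoGe : ∀ c {n S C} → ¬ NoGe (plug c (atLeastSuc n S C))
plug-ge-¬NoGe ∙                   ()
plug-ge-¬NoGe (negC c)            p = plug-ge-¬NoGe c p
plug-ge-¬NoGe (andL c D)    (p , _) = plug-ge-¬NoGe c p
plug-ge-¬NoGe (andR C c)    (_ , p) = plug-ge-¬NoGe c p
plug-ge-¬NoGe (orL c D)     (p , _) = plug-ge-¬NoGe c p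
plug-ge-¬NoGe (orR C c)     (_ , p) = plug-ge-¬NoGe c p
plug-ge-¬NoGe (allC U c)          p = plug-ge-¬NoGe c p
plug-ge-¬NoGe (exC U c)           p = plug-ge-¬NoGe c p
plug-ge-¬NoGe (atMostC n S c)     p = plug-ge-¬NoGe c p
plug-ge-¬NoGe (atLeastSucC n S c) ()

Fillers-NoGe⇒BoolCtx : ∀ c {n S C} → Fillers NoGe (plug c (atLeastSuc n S C)) → BoolCtx c
Fillers-NoGe⇒BoolCtx ∙                   _ = ∙
Fillers-NoGe⇒BoolCtx (negC c)            p = negC (Fillers-NoGe⇒BoolCtx c p)
Fillers-NoGe⇒BoolCtx (andL c D)    (p , _) = andL (Fillers-NoGe⇒BoolCtx c p)
Fillers-NoGe⇒BoolCtx (andR C c)    (_ , p) = andR (Fillers-NoGe⇒BoolCtx c p)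
Fillers-NoGe⇒BoolCtx (orL c D)     (p , _) = orL (Fillers-NoGe⇒BoolCtx c p)
Fillers-NoGe⇒BoolCtx (orR C c)     (_ , p) = orR (Fillers-NoGe⇒BoolCtx c p)
Fillers-NoGe⇒BoolCtx (allC U c)          p = ⊥-elim (plug-ge-¬NoGe c p)
Fillers-NoGe⇒BoolCtx (exC U c)           p = ⊥-elim (plug-ge-¬NoGe c p)
Fillers-NoGe⇒BoolCtx (atMostC n S c)     p = ⊥-elim (plug-ge-¬NoGe c p)
Fillers-NoGe⇒BoolCtx (atLeastSucC n S c) p = ⊥-elim (plug-ge-¬NoGe c p)

record Junctional (P : Concept → Set) : Set where
  field
    ⊓⁻ : ∀ {C D} → P (C ⊓ D) → P C × P D
    ⊓⁺ : ∀ {C D} → P C × P D → P (C ⊓ D)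
    ⊔⁻ : ∀ {C D} → P (C ⊔ D) → P C × P D
    ⊔⁺ : ∀ {C D} → P C × P D → P (C ⊔ D)

  plug⁻ : ∀ {c} → Positive c → ∀ {E} → P (plug c E) → P E
  plug⁻ ∙         p = p
  plug⁻ (andL pc) p = plug⁻ pc (proj₁ (⊓⁻ p))
  plug⁻ (andR pc) p = plug⁻ pc (proj₂ (⊓⁻ p))
  plug⁻ (orL pc)  p = plug⁻ pc (proj₁ (⊔⁻ p))
  plug⁻ (orR pc)  p = plug⁻ pc (proj₂ (⊔⁻ p))

  plug-replace : ∀ {c} → Positive c → ∀ {E E′} → P (plug c E) → P E′ → P (plug c E′)
  plug-replace ∙         _ q = q
  plug-replace (andL pc) p q = ⊓⁺ (plug-replace pc (proj₁ (⊓⁻ p)) q , proj₂ (⊓⁻ p))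
  plug-replace (andR pc) p q = ⊓⁺ (proj₁ (⊓⁻ p) , plug-replace pc (proj₂ (⊓⁻ p)) q)
  plug-replace (orL pc)  p q = ⊔⁺ (plug-replace pc (proj₁ (⊔⁻ p)) q , proj₂ (⊔⁻ p))
  plug-replace (orR pc)  p q = ⊔⁺ (proj₁ (⊔⁻ p) , plug-replace pc (proj₂ (⊔⁻ p)) q)

open Junctional using (plug⁻; plug-replace)

Junctional-IsNNF : Junctional IsNNF
Junctional-IsNNF = record { ⊓⁻ = id ; ⊓⁺ = id ; ⊔⁻ = id ; ⊔⁺ = id }

Junctional-WFC : Junctional WFC
Junctional-WFC = record { ⊓⁻ = id ; ⊓⁺ = id ; ⊔⁻ = id ; ⊔⁺ = id }

Junctional-Fillers : ∀ P → Junctional (Fillers P)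
Junctional-Fillers P = record { ⊓⁻ = id ; ⊓⁺ = id ; ⊔⁻ = id ; ⊔⁺ = id }

Junctional-× : ∀ {P Q} → Junctional P → Junctional Q → Junctional (λ C → P C × Q C)
Junctional-× JP JQ = record
  { ⊓⁻ = λ (p , q) → zip′ _,_ _,_ (⊓⁻ JP p) (⊓⁻ JQ q)
  ; ⊓⁺ = λ ((p , q) , (p′ , q′)) → ⊓⁺ JP (p , p′) , ⊓⁺ JQ (q , q′)
  ; ⊔⁻ = λ (p , q) → zip′ _,_ _,_ (⊔⁻ JP p) (⊔⁻ JQ q)
  ; ⊔⁺ = λ ((p , q) , (p′ , q′)) → ⊔⁺ JP (p , p′) , ⊔⁺ JQ (q , q′)
  }
  where open Junctional

mutual
  nnf-IsNNF : ∀ C → IsNNF (nnf C)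
  nnf-IsNNF (cn A)             = tt
  nnf-IsNNF top                = tt
  nnf-IsNNF bot                = tt
  nnf-IsNNF (neg C)            = nnfNeg-IsNNF C
  nnf-IsNNF (C ⊓ D)            = nnf-IsNNF C , nnf-IsNNF D
  nnf-IsNNF (C ⊔ D)            = nnf-IsNNF C , nnf-IsNNF D
  nnf-IsNNF (allR U C)         = nnf-IsNNF C
  nnf-IsNNF (exR U C)          = nnf-IsNNF C
  nnf-IsNNF (atMost n S C)     = nnf-IsNNF C
  nnf-IsNNF (atLeastSuc n S C) = nnf-IsNNF C

  nnfNeg-IsNNF : ∀ C → IsNNF (nnfNeg C)
  nnfNeg-IsNNF (cn A)             = tt
  nnfNeg-IsNNF top                = tt
  nnfNeg-IsNNF bot                = tt
  nnfNeg-IsNNF (neg C)            = nnf-IsNNF C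
  nnfNeg-IsNNF (C ⊓ D)            = nnfNeg-IsNNF C , nnfNeg-IsNNF D
  nnfNeg-IsNNF (C ⊔ D)            = nnfNeg-IsNNF C , nnfNeg-IsNNF D
  nnfNeg-IsNNF (allR U C)         = nnfNeg-IsNNF C
  nnfNeg-IsNNF (exR U C)          = nnfNeg-IsNNF C
  nnfNeg-IsNNF (atMost n S C)     = nnf-IsNNF C
  nnfNeg-IsNNF (atLeastSuc n S C) = nnf-IsNNF C

mutual
  nnf-WFC : ∀ C → WFC C → WFC (nnf C)
  nnf-WFC (cn A)             w       = tt
  nnf-WFC top                w       = tt
  nnf-WFC bot                w       = tt
  nnf-WFC (neg C)            w       = nnfNeg-WFC C w
  nnf-WFC (C ⊓ D)            (w , v) = nnf-WFC C w , nnf-WFC D v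
  nnf-WFC (C ⊔ D)            (w , v) = nnf-WFC C w , nnf-WFC D v
  nnf-WFC (allR U C)         (r , w) = r , nnf-WFC C w
  nnf-WFC (exR U C)          (r , w) = r , nnf-WFC C w
  nnf-WFC (atMost n S C)     w       = nnf-WFC C w
  nnf-WFC (atLeastSuc n S C) w       = nnf-WFC C w

  nnfNeg-WFC : ∀ C → WFC C → WFC (nnfNeg C)
  nnfNeg-WFC (cn A)             w       = tt
  nnfNeg-WFC top                w       = tt
  nnfNeg-WFC bot                w       = tt
  nnfNeg-WFC (neg C)            w       = nnf-WFC C w
  nnfNeg-WFC (C ⊓ D)            (w , v) = nnfNeg-WFC C w , nnfNeg-WFC D v
  nnfNeg-WFC (C ⊔ D)            (w , v) = nnfNeg-WFC C w , nnfNeg-WFC D v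
  nnfNeg-WFC (allR U C)         (r , w) = r , nnfNeg-WFC C w
  nnfNeg-WFC (exR U C)          (r , w) = r , nnfNeg-WFC C w
  nnfNeg-WFC (atMost n S C)     w       = nnf-WFC C w
  nnfNeg-WFC (atLeastSuc n S C) w       = nnf-WFC C w

WFNNF : Concept → Set
WFNNF C = IsNNF C × WFC C

ShallowGe : Concept → Set
ShallowGe C = WFNNF C × Fillers NoGe C

Junctional-WFNNF : Junctional WFNNF
Junctional-WFNNF = Junctional-× Junctional-IsNNF Junctional-WFC

Junctional-ShallowGe : Junctional ShallowGe
Junctional-ShallowGe = Junctional-× Junctional-WFNNF (Junctional-Fillers NoGe)

WFNNFKB : KB → Set
WFNNFKB K = All WFNNF (tbox K) × All WFRAx (rbox K)

ShallowGeKB : KB → Set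
ShallowGeKB K = All ShallowGe (tbox K) × All WFRAx (rbox K)

nnfKB-WFNNFKB : ∀ K → WFKB K → WFNNFKB (nnfKB K)
nnfKB-WFNNFKB (kb T R P) (wT , wR) = map⁺ (All.map (λ {C} w → nnf-IsNNF C , nnf-WFC C w) wT) , wR

mkQ-WFNNF⁻ : ∀ q {D} → WFNNF (mkQ q D) → WFNNF D
mkQ-WFNNF⁻ (qall U)  (n , _ , w) = n , w
mkQ-WFNNF⁻ (qex U)   (n , _ , w) = n , w
mkQ-WFNNF⁻ (qle _ _) p           = p
mkQ-WFNNF⁻ (qge _ _) p           = p

mkQ-WFNNF-name : ∀ q {D} F → WFNNF (mkQ q D) → WFNNF (mkQ q (cn F))
mkQ-WFNNF-name (qall U)  F (_ , r , _) = tt , r , tt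
mkQ-WFNNF-name (qex U)   F (_ , r , _) = tt , r , tt
mkQ-WFNNF-name (qle _ _) F _           = tt , tt
mkQ-WFNNF-name (qge _ _) F _           = tt , tt

newAx-WFNNF : ∀ q F {D} → WFNNF D → WFNNF (newAx q F D)
newAx-WFNNF (qall U)  F     (n , w) = (tt , n) , (tt , w)
newAx-WFNNF (qex U)   F     (n , w) = (tt , n) , (tt , w)
newAx-WFNNF (qge _ _) F     (n , w) = (tt , n) , (tt , w)
newAx-WFNNF (qle _ _) F {D} (_ , w) = (nnfNeg-IsNNF D , tt) , (nnfNeg-WFC D w , tt)

redex-Positive : ∀ pre {c q D post} → BoolCtx c → All WFNNF (pre ++ plug c (mkQ q D) ∷ post) → Positive c
redex-Positive pre {q = q} b okT = BoolCtx∧IsNNF⇒Positive b (mkQ-¬IsName q) (proj₁ (All-focus pre okT))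

FlatStep-WFNNFKB : ∀ {K K′} → FlatStep K K′ → WFNNFKB K → WFNNFKB K′
FlatStep-WFNNFKB (flatStep pre post c q D F b _ _) (okT , okR) =
  All-splice pre okT (λ ok → plug-replace J pos ok (mkQ-WFNNF-name q F (plug⁻ J pos ok)))
             (newAx-WFNNF q F (mkQ-WFNNF⁻ q (plug⁻ J pos (All-focus pre okT))) ∷ []) ,
  okR
  where
  J = Junctional-WFNNF
  pos = redex-Positive pre b okT

exConj-ShallowGe : ∀ n rs A → ShallowGe (exConj n rs A)
exConj-ShallowGe zero    rs A = (tt , refl , tt) , tt
exConj-ShallowGe (suc n) rs A with exConj-ShallowGe n (rs ∘ suc) A
... | (nnf , wf) , fillers = ((tt , nnf) , (refl , tt) , wf) , (tt , fillers)

disjAx-ShallowGe : ∀ n rs → All ShallowGe (disjAx n rs)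
disjAx-ShallowGe zero    rs = []
disjAx-ShallowGe (suc n) rs =
  ++⁺ (from (All-map-allFin _) λ _ → (tt , refl , tt) , tt) (disjAx-ShallowGe n (rs ∘ suc))

subAx-WFRAx : ∀ n rs S → All WFRAx (subAx n rs S)
subAx-WFRAx n rs S = from (All-map-allFin _) λ _ → refl , refl

ge-Positive : ∀ pre {c n S A post} → All ShallowGe (pre ++ plug c (atLeastSuc n S A) ∷ post) → Positive c
ge-Positive pre {c} okT with All-focus pre okT
... | (nnf , _) , fillers = BoolCtx∧IsNNF⇒Positive (Fillers-NoGe⇒BoolCtx c fillers) (λ { (_ , ()) }) nnf

EgeStep-ShallowGeKB : ∀ {K K′} → EgeStep K K′ → ShallowGeKB K → ShallowGeKB K′
EgeStep-ShallowGeKB (egeStep pre post c n S A rs _ _) (okT , okR) =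
  All-splice pre okT (λ ok → plug-replace Junctional-ShallowGe (ge-Positive pre okT) ok (exConj-ShallowGe n rs A))
             (disjAx-ShallowGe n rs) ,
  ++⁺ okR (subAx-WFRAx n rs S)

-- Soundness of a FLAT step

Equisatisfiable : KB → KB → Set₁
Equisatisfiable K K′ = (Satisfiable K → Satisfiable K′) × (Satisfiable K′ → Satisfiable K)

Equisatisfiable-trans : ∀ {K₁ K₂ K₃} →
                        Equisatisfiable K₁ K₂ → Equisatisfiable K₂ K₃ → Equisatisfiable K₁ K₃
Equisatisfiable-trans (f , g) (f′ , g′) = f′ ∘ f , g ∘ g′

cnamesC-plug : ∀ c {E} → cnamesC E ⊆ cnamesC (plug c E)
cnamesC-plug ∙                   m = m
cnamesC-plug (negC c)            m = cnamesC-plug c m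
cnamesC-plug (andL c D)          m = ∈-++⁺ˡ (cnamesC-plug c m)
cnamesC-plug (andR C c)          m = ∈-++⁺ʳ (cnamesC C) (cnamesC-plug c m)
cnamesC-plug (orL c D)           m = ∈-++⁺ˡ (cnamesC-plug c m)
cnamesC-plug (orR C c)           m = ∈-++⁺ʳ (cnamesC C) (cnamesC-plug c m)
cnamesC-plug (allC U c)          m = cnamesC-plug c m
cnamesC-plug (exC U c)           m = cnamesC-plug c m
cnamesC-plug (atMostC n S c)     m = cnamesC-plug c m
cnamesC-plug (atLeastSucC n S c) m = cnamesC-plug c m

rnamesC-plug : ∀ c {E} → rnamesC E ⊆ rnamesC (plug c E)
rnamesC-plug ∙                   m = m
rnamesC-plug (negC c)            m = rnamesC-plug c m
rnamesC-plug (andL c D)          m = ∈-++⁺ˡ (rnamesC-plug c m)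
rnamesC-plug (andR C c)          m = ∈-++⁺ʳ (rnamesC C) (rnamesC-plug c m)
rnamesC-plug (orL c D)           m = ∈-++⁺ˡ (rnamesC-plug c m)
rnamesC-plug (orR C c)           m = ∈-++⁺ʳ (rnamesC C) (rnamesC-plug c m)
rnamesC-plug (allC U c)          m = ∈-++⁺ʳ (rnamesU U) (rnamesC-plug c m)
rnamesC-plug (exC U c)           m = ∈-++⁺ʳ (rnamesU U) (rnamesC-plug c m)
rnamesC-plug (atMostC n S c)     m = there (rnamesC-plug c m)
rnamesC-plug (atLeastSucC n S c) m = there (rnamesC-plug c m)

mkQ-cnamesC : ∀ q {D} → cnamesC D ⊆ cnamesC (mkQ q D)
mkQ-cnamesC (qall U)  = id
mkQ-cnamesC (qex U)   = id
mkQ-cnamesC (qle n S) = id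
mkQ-cnamesC (qge n S) = id

tbox-cnamesC : ∀ pre {C post R P} → cnamesC C ⊆ conceptNames (kb (pre ++ C ∷ post) R P)
tbox-cnamesC pre m = ∈-++⁺ˡ (∈-concatMap⁺ cnamesC (Anyₚ.++⁺ʳ pre (here m)))

tbox-rnamesC : ∀ pre {C post R P} → rnamesC C ⊆ roleNames (kb (pre ++ C ∷ post) R P)
tbox-rnamesC pre m = ∈-++⁺ˡ (∈-concatMap⁺ rnamesC (Anyₚ.++⁺ʳ pre (here m)))

defineConcept : (I : Interp) → ℕ → Concept → Interp
defineConcept I F D =
  reinterpret I (λ A x → (A ≡ F × Sem.⟦_⟧c I D x) ⊎ (A ≢ F × Interp.conI I A x)) (Interp.roleI I)

module DefineConcept (I : Interp) (F : ℕ) (D : Concept) where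
  open Interp I
  open Coincidence I (λ A x → (A ≡ F × Sem.⟦_⟧c I D x) ⊎ (A ≢ F × conI A x)) roleI

  private
    J = defineConcept I F D

    same-off-F : ∀ {A} → F ≢ A → SameConcept A
    same-off-F F≢A x =
      mk⇔ (λ a → inj₂ (F≢A ∘ sym , a)) [ (λ (A≡F , _) → ⊥-elim (F≢A (sym A≡F))) , proj₂ ]

    same-fresh : ∀ {ns} → F ∉ ns → All SameConcept ns
    same-fresh F∉ns = All.map same-off-F (¬Any⇒All¬ _ F∉ns)

    same-roles : ∀ ns → All SameRole ns
    same-roles ns = All.tabulate λ _ x y → ⇔-id _

  models : ∀ K → F ∉ conceptNames K → Sem.Models I K → Sem.Models J K
  models K F∉K = Models-agree K (same-fresh F∉K) (same-roles _)

  defines : F ∉ cnamesC D → ∀ x → Interp.conI J F x ⇔ Sem.⟦_⟧c J D x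
  defines F∉D x = ⇔-trans (mk⇔ [ proj₂ , (λ (F≢F , _) → ⊥-elim (F≢F refl)) ] (λ d → inj₁ (refl , d)))
                          (⟦⟧c-agree D (same-fresh F∉D) (same-roles _) x)

module _ (em : ExcludedMiddle 0ℓ) where
  open Classical em

  module _ (I : Interp) where
    open Interp I
    open Sem I

    filler-by-name : ∀ q F D → AxSat (newAx q F D) → ∀ x → ⟦ mkQ q (cn F) ⟧c x → ⟦ mkQ q D ⟧c x
    filler-by-name (qall U)  F D ax x f y u       = subsumption I {cn F} {D} ax y (f y u)
    filler-by-name (qex U)   F D ax x (y , u , a) = y , u , subsumption I {cn F} {D} ax y a
    filler-by-name (qge n S) F D ax = atLeastSuc-mono I n S {cn F} {D} (subsumption I {cn F} {D} ax)
    filler-by-name (qle n S) F D ax = atMost-antitone I n S {D} {cn F} (subsumption I {D} {cn F} ax)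

    newAx-sat : ∀ q F D → (∀ x → conI F x ⇔ ⟦ D ⟧c x) → AxSat (newAx q F D)
    newAx-sat (qall U)  F D F≡D = subsumption-complete I {cn F} {D} (to ∘ F≡D)
    newAx-sat (qex U)   F D F≡D = subsumption-complete I {cn F} {D} (to ∘ F≡D)
    newAx-sat (qge n S) F D F≡D = subsumption-complete I {cn F} {D} (to ∘ F≡D)
    newAx-sat (qle n S) F D F≡D = subsumption-complete I {D} {cn F} (from ∘ F≡D)

  FlatStep-equisat : ∀ {K K′} → FlatStep K K′ → WFNNFKB K → Equisatisfiable K K′
  FlatStep-equisat {K} (flatStep {R} {P} pre post c q D F b _ F∉K) (okT , _) = forward , backward
    where
    pos = redex-Positive pre b okT

    F∉D : F ∉ cnamesC D
    F∉D m = F∉K (tbox-cnamesC pre {R = R} {P = P} (cnamesC-plug c (mkQ-cnamesC q m)))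

    forward : Satisfiable K → Satisfiable _
    forward (I , m) with DefineConcept.models I F D K F∉K m
    ... | mT , mR , mP = J , All-splice pre mT replace (newAx-sat J q F D F≡D ∷ []) , mR , mP
      where
      J = defineConcept I F D
      F≡D = DefineConcept.defines I F D F∉D
      replace : Sem.AxSat J (plug c (mkQ q D)) → Sem.AxSat J (plug c (mkQ q (cn F)))
      replace sat x = from (plug-cong J c {mkQ q (cn F)} {mkQ q D} (mkQ-cong J q {cn F} {D} F≡D) x) (sat x)

    backward : Satisfiable _ → Satisfiable K
    backward (I , mT , mR , mP) = I , All-unsplice pre mT restore , mR , mP
      where
      restore : All (Sem.AxSat I) (newAx q F D ∷ []) →
                Sem.AxSat I (plug c (mkQ q (cn F))) → Sem.AxSat I (plug c (mkQ q D))
      restore (ax ∷ []) sat x = plug-mono I pos (filler-by-name I q F D ax) x (sat x)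

-- Soundness of an Ege step

module _ (I : Interp) where
  open Interp I
  open Sem I

  exConj-sound : ∀ n rs A x → ⟦ exConj n rs A ⟧c x ⇔ (∀ i → ⟦ exR (at (rn (rs i))) (cn A) ⟧c x)
  exConj-sound zero    rs A x = mk⇔ (λ { e zero → e }) (λ f → f zero)
  exConj-sound (suc n) rs A x = mk⇔
    (λ { (e , es) zero → e ; (e , es) (suc i) → to (exConj-sound n (rs ∘ suc) A x) es i })
    (λ f → f zero , from (exConj-sound n (rs ∘ suc) A x) (f ∘ suc))

  Disjoint : ∀ {m} → (Fin m → ℕ) → Set
  Disjoint rs = ∀ i j → i ≢ j → ∀ x y → roleI (rs i) x y → ¬ roleI (rs j) x y

  disjAx-sound : ∀ n rs → All AxSat (disjAx n rs) ⇔ Disjoint rs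
  disjAx-sound zero    rs = mk⇔ (λ { _ zero zero 0≢0 → ⊥-elim (0≢0 refl) }) (λ _ → [])
  disjAx-sound (suc n) rs = mk⇔ split join
    where
    apart₀ : Fin (suc n) → Concept
    apart₀ j = allR (rand (at (rn (rs zero))) (at (rn (rs (suc j))))) bot

    split : All AxSat (disjAx (suc n) rs) → Disjoint rs
    split sats zero    zero    0≢0 = ⊥-elim (0≢0 refl)
    split sats zero    (suc j) _ x y r₀ rⱼ = to (All-map-allFin apart₀) (++⁻ˡ _ sats) j x y (r₀ , rⱼ)
    split sats (suc i) zero    _ x y rᵢ r₀ = to (All-map-allFin apart₀) (++⁻ˡ _ sats) i x y (r₀ , rᵢ)
    split sats (suc i) (suc j) i≢j =
      to (disjAx-sound n (rs ∘ suc)) (++⁻ʳ (map apart₀ (allFin (suc n))) sats) i j (i≢j ∘ cong suc)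

    join : Disjoint rs → All AxSat (disjAx (suc n) rs)
    join disjoint =
      ++⁺ (from (All-map-allFin apart₀) λ j x y (r₀ , rⱼ) → disjoint zero (suc j) (λ ()) x y r₀ rⱼ)
          (from (disjAx-sound n (rs ∘ suc)) λ i j i≢j → disjoint (suc i) (suc j) (i≢j ∘ suc-injective))

  subAx-sound : ∀ n rs S → All RAxSat (subAx n rs S) ⇔ (∀ i x y → roleI (rs i) x y → ⟦ S ⟧r x y)
  subAx-sound n rs S = All-map-allFin _

  exConj⇒atLeastSuc : ∀ n rs S A → Disjoint rs → (∀ i x y → roleI (rs i) x y → ⟦ S ⟧r x y) →
                      ∀ x → ⟦ exConj n rs A ⟧c x → ⟦ atLeastSuc n S (cn A) ⟧c x
  exConj⇒atLeastSuc n rs S A disjoint sub x e =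
    proj₁ ∘ w , injective , λ i → sub i x _ (proj₁ (proj₂ (w i))) , proj₂ (proj₂ (w i))
    where
    w = to (exConj-sound n rs A x) e
    injective : ∀ i j → proj₁ (w i) ≡ proj₁ (w j) → i ≡ j
    injective i j eq = decidable-stable (i ≟ᶠ j) λ i≢j →
      disjoint i j i≢j x _ (subst (roleI (rs i) x) eq (proj₁ (proj₂ (w i)))) (proj₁ (proj₂ (w j)))

defineRoles : (I : Interp) → ∀ {m} → (Fin m → ℕ) → (Fin m → Interp.Δ I → Interp.Δ I → Set) → Interp
defineRoles I {m} rs W = reinterpret I (Interp.conI I) λ R x y →
  (Σ (Fin m) λ i → rs i ≡ R × W i x y) ⊎ ((∀ i → rs i ≢ R) × Interp.roleI I R x y)

module DefineRoles (I : Interp) {m} (rs : Fin m → ℕ) (W : Fin m → Interp.Δ I → Interp.Δ I → Set) where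
  open Interp I
  open Coincidence I conI
    (λ R x y → (Σ (Fin m) λ i → rs i ≡ R × W i x y) ⊎ ((∀ i → rs i ≢ R) × roleI R x y))

  private
    J = defineRoles I rs W

    same-off-rs : ∀ {R} → (∀ i → rs i ≢ R) → SameRole R
    same-off-rs rs≢R x y =
      mk⇔ (λ r → inj₂ (rs≢R , r)) [ (λ (i , rsᵢ≡R , _) → ⊥-elim (rs≢R i rsᵢ≡R)) , proj₂ ]

  models : ∀ K → (∀ i → rs i ∉ roleNames K) → Sem.Models I K → Sem.Models J K
  models K fresh = Models-agree K (All.tabulate λ _ x → ⇔-id _)
                                  (All.tabulate λ R∈K → same-off-rs λ { i refl → fresh i R∈K })

  keeps : ∀ S → (∀ i → rs i ≢ rnameRole S) → ∀ x y → Sem.⟦_⟧r I S x y ⇔ Sem.⟦_⟧r J S x y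
  keeps S rs≢S = ⟦⟧r-agree S (same-off-rs rs≢S)

  defines : (∀ i j → rs i ≡ rs j → i ≡ j) → ∀ i x y → Interp.roleI J (rs i) x y ⇔ W i x y
  defines rs-injective i x y = mk⇔
    [ (λ (k , rsₖ≡rsᵢ , w) → subst (λ k → W k x y) (rs-injective k i rsₖ≡rsᵢ) w)
    , (λ (rs≢rsᵢ , _) → ⊥-elim (rs≢rsᵢ i refl)) ]
    (λ w → inj₁ (i , refl , w))

module _ (I : Interp) {n : ℕ} {P : Interp.Δ I → Interp.Δ I → Set} where
  open Interp I
  open Sem I

  chosen : ∀ {x} → Dec (AtLeast (suc n) (P x)) → Fin (suc n) → Δ → Set
  chosen (yes (f , _)) i y = f i ≡ y
  chosen (no _)        i y = ⊥

  chosen-sound : ∀ {x} d i y → chosen {x} d i y → P x y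
  chosen-sound (yes (f , _ , p)) i y refl = p i

  chosen-disjoint : ∀ {x} d i j y → chosen {x} d i y → chosen d j y → i ≡ j
  chosen-disjoint (yes (f , f-injective , _)) i j y fᵢ≡y fⱼ≡y = f-injective i j (trans fᵢ≡y (sym fⱼ≡y))

  chosen-total : ∀ {x} d → AtLeast (suc n) (P x) → ∀ i → Σ Δ (chosen {x} d i)
  chosen-total (yes (f , _)) _   i = f i , refl
  chosen-total (no ¬atl)     atl i = ⊥-elim (¬atl atl)

module _ (em : ExcludedMiddle 0ℓ) where

  EgeStep-equisat : ∀ {K K′} → EgeStep K K′ → ShallowGeKB K → Equisatisfiable K K′
  EgeStep-equisat {K} (egeStep {R} {P} pre post c n S A rs rs-injective fresh) (okT , _) = forward , backward
    where
    pos = ge-Positive pre okT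

    rs≢S : ∀ i → rs i ≢ rnameRole S
    rs≢S i rsᵢ≡S = fresh i (subst (_∈ roleNames K) (sym rsᵢ≡S)
                                  (tbox-rnamesC pre {R = R} {P = P} (rnamesC-plug c (here refl))))

    forward : Satisfiable K → Satisfiable _
    forward (I , m) = J , All-splice pre mT replace (from (disjAx-sound J n rs) disjoint) ,
                      ++⁺ mR (from (subAx-sound J n rs S) sub) , mP
      where
      open Interp I

      Succ : Δ → Δ → Set
      Succ x y = Sem.⟦_⟧r I S x y × conI A y

      decide : ∀ x → Dec (Sem.AtLeast I (suc n) (Succ x))
      decide x = em

      W : Fin (suc n) → Δ → Δ → Set
      W i x y = chosen I (decide x) i y

      J = defineRoles I rs W
      J-models = DefineRoles.models I rs W K fresh m
      mT = proj₁ J-models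
      mR = proj₁ (proj₂ J-models)
      mP = proj₂ (proj₂ J-models)

      S-kept = DefineRoles.keeps I rs W S rs≢S
      rs-W = DefineRoles.defines I rs W rs-injective

      disjoint : Disjoint J rs
      disjoint i j i≢j x y rᵢ rⱼ =
        i≢j (chosen-disjoint I {n} {Succ} (decide x) i j y (to (rs-W i x y) rᵢ) (to (rs-W j x y) rⱼ))

      sub : ∀ i x y → Interp.roleI J (rs i) x y → Sem.⟦_⟧r J S x y
      sub i x y r = to (S-kept x y) (proj₁ (chosen-sound I {n} {Succ} (decide x) i y (to (rs-W i x y) r)))

      atLeast⇒exConj : ∀ x → Sem.⟦_⟧c J (atLeastSuc n S (cn A)) x → Sem.⟦_⟧c J (exConj n rs A) x
      atLeast⇒exConj x atl = from (exConj-sound J n rs A x) λ i →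
        let (y , w) = chosen-total I {n} {Succ} (decide x) atlᴵ i
        in y , from (rs-W i x y) w , proj₂ (chosen-sound I {n} {Succ} (decide x) i y w)
        where
        atlᴵ : Sem.AtLeast I (suc n) (Succ x)
        atlᴵ = AtLeast-map I {P = λ y → Sem.⟦_⟧r J S x y × conI A y}
                             (λ y (s , a) → from (S-kept x y) s , a) atl

      replace : Sem.AxSat J (plug c (atLeastSuc n S (cn A))) → Sem.AxSat J (plug c (exConj n rs A))
      replace sat x = plug-mono J pos atLeast⇒exConj x (sat x)

    backward : Satisfiable _ → Satisfiable K
    backward (I , mT , mR , mP) = I , All-unsplice pre mT restore , ++⁻ˡ R mR , mP
      where
      restore : All (Sem.AxSat I) (disjAx n rs) →
                Sem.AxSat I (plug c (exConj n rs A)) → Sem.AxSat I (plug c (atLeastSuc n S (cn A)))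
      restore disj sat x = plug-mono I pos (exConj⇒atLeastSuc I n rs S A (to (disjAx-sound I n rs) disj)
                                                                 (to (subAx-sound I n rs S) (++⁻ʳ R mR))) x (sat x)

-- Exhaustive flattening

fresh : List ℕ → ℕ
fresh ns = suc (max 0 ns)

fresh-∉ : ∀ ns → fresh ns ∉ ns
fresh-∉ ns m = <-irrefl refl (All.lookup (xs≤max 0 ns) m)

isName? : ∀ D → Dec (IsName D)
isName? (cn A)             = yes (A , refl)
isName? top                = no λ { (_ , ()) }
isName? bot                = no λ { (_ , ()) }
isName? (neg D)            = no λ { (_ , ()) }
isName? (D ⊓ E)            = no λ { (_ , ()) }
isName? (D ⊔ E)            = no λ { (_ , ()) }
isName? (allR U D)         = no λ { (_ , ()) }
isName? (exR U D)          = no λ { (_ , ()) }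
isName? (atMost n S D)     = no λ { (_ , ()) }
isName? (atLeastSuc n S D) = no λ { (_ , ()) }

NoFlatRedex : Concept → Set
NoFlatRedex C = ∀ c q D → BoolCtx c → ¬ IsName D → C ≢ plug c (mkQ q D)

mkQ-NoFlatRedex⇒IsName : ∀ q D → NoFlatRedex (mkQ q D) → IsName D
mkQ-NoFlatRedex⇒IsName q D noRedex with isName? D
... | yes name  = name
... | no ¬name = ⊥-elim (noRedex ∙ q D ∙ ¬name refl)

NoFlatRedex⇒Fillers-IsName : ∀ C → NoFlatRedex C → Fillers IsName C
NoFlatRedex⇒Fillers-IsName (cn A) _ = tt
NoFlatRedex⇒Fillers-IsName top    _ = tt
NoFlatRedex⇒Fillers-IsName bot    _ = tt
NoFlatRedex⇒Fillers-IsName (neg C) noRedex = NoFlatRedex⇒Fillers-IsName C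
  λ c q E b ¬name e → noRedex (negC c) q E (negC b) ¬name (cong neg e)
NoFlatRedex⇒Fillers-IsName (C ⊓ D) noRedex =
  NoFlatRedex⇒Fillers-IsName C (λ c q E b ¬name e → noRedex (andL c D) q E (andL b) ¬name (cong (_⊓ D) e)) ,
  NoFlatRedex⇒Fillers-IsName D (λ c q E b ¬name e → noRedex (andR C c) q E (andR b) ¬name (cong (C ⊓_) e))
NoFlatRedex⇒Fillers-IsName (C ⊔ D) noRedex =
  NoFlatRedex⇒Fillers-IsName C (λ c q E b ¬name e → noRedex (orL c D) q E (orL b) ¬name (cong (_⊔ D) e)) ,
  NoFlatRedex⇒Fillers-IsName D (λ c q E b ¬name e → noRedex (orR C c) q E (orR b) ¬name (cong (C ⊔_) e))
NoFlatRedex⇒Fillers-IsName (allR U C)         = mkQ-NoFlatRedex⇒IsName (qall U) C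
NoFlatRedex⇒Fillers-IsName (exR U C)          = mkQ-NoFlatRedex⇒IsName (qex U) C
NoFlatRedex⇒Fillers-IsName (atMost n S C)     = mkQ-NoFlatRedex⇒IsName (qle n S) C
NoFlatRedex⇒Fillers-IsName (atLeastSuc n S C) = mkQ-NoFlatRedex⇒IsName (qge n S) C

FlatNormal⇒NoFlatRedex : ∀ {T R P C} → (∀ K′ → ¬ FlatStep (kb T R P) K′) → C ∈ T → NoFlatRedex C
FlatNormal⇒NoFlatRedex normal C∈T c q D b ¬name C≡ with ∈-∃++ C∈T
... | pre , post , refl with C≡
... | refl = normal _ (flatStep pre post c q D _ b ¬name (fresh-∉ _))

FlatNormal⇒ShallowGeKB : ∀ K → (∀ K′ → ¬ FlatStep K K′) → WFNNFKB K → ShallowGeKB K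
FlatNormal⇒ShallowGeKB (kb T R P) normal (okT , okR) = All.zipWith (λ {C} → shallow {C}) (okT , names) , okR
  where
  names : All (Fillers IsName) T
  names = All.tabulate λ {C} C∈T → NoFlatRedex⇒Fillers-IsName C (FlatNormal⇒NoFlatRedex normal C∈T)

  shallow : ∀ {C} → WFNNF C × Fillers IsName C → ShallowGe C
  shallow {C} (ok , fillers) = ok , Fillers-map IsName⇒NoGe C fillers

ShallowGeKB∧NoGeKB⇒IsALCHIbLe : ∀ K → ShallowGeKB K → NoGeKB K → IsALCHIbLe K
ShallowGeKB∧NoGeKB⇒IsALCHIbLe K (okT , okR) noGe =
  (All.map (proj₂ ∘ proj₁) okT , okR) , All.zipWith (λ (((nnf , _) , _) , ng) → nnf , ng) (okT , noGe)

module _ {Step : KB → KB → Set} {Inv : KB → Set}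
         (preserves : ∀ {K K′} → Step K K′ → Inv K → Inv K′) where

  Star-preserves : ∀ {K K′} → Star Step K K′ → Inv K → Inv K′
  Star-preserves = Star.fold (λ K K′ → Inv K → Inv K′) (λ s rest → rest ∘ preserves s) id

  Star-equisat : (∀ {K K′} → Step K K′ → Inv K → Equisatisfiable K K′) →
                 ∀ {K K′} → Star Step K K′ → Inv K → Equisatisfiable K K′
  Star-equisat sound = Star.fold (λ K K′ → Inv K → Equisatisfiable K K′)
    (λ s rest inv → Equisatisfiable-trans (sound s inv) (rest (preserves s inv))) (λ _ → id , id)

nnfKB-equisat : ExcludedMiddle 0ℓ → ∀ K → Equisatisfiable K (nnfKB K)
nnfKB-equisat em K = (λ (I , m) → I , from (Models-nnfKB I K) m) , (λ (I , m) → I , to (Models-nnfKB I K) m)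
  where open Classical em

lemma6p7 : ExcludedMiddle 0ℓ → (K : KB) → WFKB K → (K' : KB) → Ege K K'
    → IsALCHIbLe K' × (Satisfiable K → Satisfiable K') × (Satisfiable K' → Satisfiable K)
lemma6p7 em K wf K′ (K₁ , (flat , normal) , ege , noGe) =
  ShallowGeKB∧NoGeKB⇒IsALCHIbLe K′ inv′ noGe ,
  Equisatisfiable-trans (nnfKB-equisat em K)
    (Equisatisfiable-trans (Star-equisat FlatStep-WFNNFKB (FlatStep-equisat em) flat inv₀)
                           (Star-equisat EgeStep-ShallowGeKB (EgeStep-equisat em) ege inv₁))
  where
  inv₀ = nnfKB-WFNNFKB K wf
  inv₁ = FlatNormal⇒ShallowGeKB K₁ normal (Star-preserves FlatStep-WFNNFKB flat inv₀)
  inv′ = Star-preserves EgeStep-ShallowGeKB ege inv₁
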